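{- Let $n\ge 0$ and let $\bar s$ be any equivalence class, under pivoting, of complete binary trees with $2n+1$ vertices. Let $T(\bar s)=\sum_{s\in\bar s}\#\mathcal L(s)$, where $\mathcal L(s)$ is the set of increasing labellings of $s$. Then $(n+1)T(\bar s)$ is divisible by $2^{2n}$.
   Context: A complete binary tree is a rooted binary tree (each vertex has an ordered left and right subtree) in which the two subtrees of each vertex are either both empty or both non-empty. An increasing labelling of a tree with $N$ vertices is a bijective labelling of its vertices by $\{1,\dots,N\}$ such that the label of each vertex is smaller than the labels of its descendants; $\mathcal L(s)$ denotes the set of these. A basic pivoting of a complete binary tree is the exchange of the two subtrees of some non-leaf vertex; two complete binary trees are equivalent under pivoting if one can be transformed into the other by a finite sequence of basic pivotings. -}

module Defs where

open import Data.Nat using (ℕ; zero; suc; _+_; _<ᵇ_; _≡ᵇ_)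
open import Data.Bool using (Bool; true; false; _∧_; _∨_; if_then_else_)
open import Data.List using (List; []; _∷_; _++_; map; concatMap; length; filterᵇ)
open import Data.Bool.ListAction using (all; any)
open import Relation.Binary.Construct.Closure.ReflexiveTransitive using (Star)

data Tree : Set where
  leaf : Tree
  node : Tree → Tree → Tree

size : Tree → ℕ
size leaf       = 1
size (node l r) = suc (size l + size r)

data Pivot : Tree → Tree → Set where
  here  : ∀ {l r}      → Pivot (node l r) (node r l)
  left  : ∀ {l l' r}   → Pivot l l' → Pivot (node l r) (node l' r)
  right : ∀ {l r r'}   → Pivot r r' → Pivot (node l r) (node l r')

_~_ : Tree → Tree → Set
_~_ = Star Pivot

data LTree : Set where
  lleaf : ℕ → LTree
  lnode : ℕ → LTree → LTree → LTree

shape : LTree → Tree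
shape (lleaf _)     = leaf
shape (lnode _ l r) = node (shape l) (shape r)

labels : LTree → List ℕ
labels (lleaf a)     = a ∷ []
labels (lnode a l r) = a ∷ labels l ++ labels r

increasingᵇ : LTree → Bool
increasingᵇ (lleaf _)     = true
increasingᵇ (lnode a l r) =
  all (a <ᵇ_) (labels l ++ labels r) ∧ increasingᵇ l ∧ increasingᵇ r

oneTo : ℕ → List ℕ
oneTo zero    = []
oneTo (suc n) = oneTo n ++ (suc n ∷ [])

memberᵇ : ℕ → List ℕ → Bool
memberᵇ x = any (x ≡ᵇ_)

labellingsFrom : List ℕ → Tree → List LTree
labellingsFrom pool leaf       = map lleaf pool
labellingsFrom pool (node l r) =
  concatMap (λ a → concatMap (λ L → map (lnode a L) (labellingsFrom pool r))
                             (labellingsFrom pool l)) pool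

-- A labelling of s (N = size s vertices) by values in {1..N} is bijective iff
-- every value of {1..N} occurs (N vertices, N values).
isIncreasingLabellingᵇ : Tree → LTree → Bool
isIncreasingLabellingᵇ s t =
  all (λ i → memberᵇ i (labels t)) (oneTo (size s)) ∧ increasingᵇ t

-- The set L(s) of increasing labellings of s, as a duplicate-free list
-- (distinct label assignments of the vertices of s).
incLabellings : Tree → List LTree
incLabellings s = filterᵇ (isIncreasingLabellingᵇ s) (labellingsFrom (oneTo (size s)) s)

#L : Tree → ℕ
#L s = length (incLabellings s)

module Submission where

-- Write |s| for the size of
-- a tree and h(s) = #L(s) for its number of increasing labellings.
--  * Hook recursion: h(node a b) = C(|a|+|b|, |a|)·h(a)·h(b), because the root
--    gets the least label and the remaining labels are split between the
--    subtrees in C(|a|+|b|, |a|) ways.  This is proved by an explicit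
--    enumeration `labellingsOn` of increasing labellings and a comparison with
--    the brute-force list of Defs (same elements, both duplicate-free).
--  * Pivot classes: the class of node l r is {node a b | a ~ l, b ~ r}, plus
--    the mirrored trees when l and r are not equivalent.  Hence
--    T(node l r) = c·C(|l|+|r|, |l|)·T(l)·T(r) with c = 1 if l ~ r and c = 2
--    otherwise (`classTotal`).
--  * 2-adic invariant: 2^|t| divides (|t|+1)·T(t), by induction on t.  The step
--    uses (p+1)(q+1)·C(p+q+2, p+1) = (p+q+1)(p+q+2)·C(p+q, p), the evenness of
--    c·C(p+q+2, p+1), and the cancellation of the odd factor p+q+1.
-- With |t| = 2n+1 the invariant reads 2·2^(2n) | 2·(n+1)·T(t).

open import Defs
open import Data.Nat using (ℕ; _+_; _*_; _^_)
open import Data.Nat.Divisibility using (_∣_)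
open import Data.List using (List; map)
open import Data.Nat.ListAction using (sum)
open import Data.List.Relation.Unary.Unique.Propositional using (Unique)
open import Data.List.Membership.Propositional using (_∈_)
open import Relation.Binary.PropositionalEquality using (_≡_)
open import Function.Bundles using (_⇔_)

open import Data.Bool using (T)
open import Data.Bool.ListAction using (all)
open import Data.Bool.Properties using (T-∧)
open import Data.Empty using (⊥; ⊥-elim)
open import Data.Nat using (zero; suc; _≤_; _<_; z≤n; s≤s; s<s; _≡ᵇ_; _<ᵇ_)
open import Data.Nat.Properties
  using ( _≟_; +-comm; +-suc; +-identityʳ; +-cancelˡ-≡; *-comm; *-assoc; *-identityˡ; *-zeroʳ
        ; *-distribˡ-+; ^-distribˡ-+-*; suc-injective; ≤-refl; ≤-reflexive; ≤-antisym; ≤-pred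
        ; <-irrefl; <⇒≤; <⇒≱; m<n⇒m<1+n; ≡ᵇ⇒≡; ≡⇒≡ᵇ; <ᵇ⇒<; <⇒<ᵇ )
open import Data.Nat.Divisibility
  using (divides; 1∣_; m∣m*n; ∣n⇒∣m*n; m*n∣⇒m∣; *-pres-∣; *-monoʳ-∣; *-cancelˡ-∣)
open import Data.Nat.Coprimality as Coprime using (Coprime; coprime-divisor; coprime-+; 1-coprimeTo)
open import Data.Nat.ListAction.Properties using (sum-↭; sum-++)
open import Data.Nat.Tactic.RingSolver using (solve-∀)
open import Data.List
  using ([]; _∷_; _++_; _∷ʳ_; length; filter; concatMap; cartesianProductWith; applyUpTo)
open import Data.List.Properties
  using (map-++; map-cong; length-++; length-map; applyUpTo-∷ʳ; length-applyUpTo)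
open import Data.List.Membership.Propositional using (find; lose)
open import Data.List.Membership.Propositional.Properties
  using ( ∈-∃++; ∈-++⁺ˡ; ∈-++⁺ʳ; ∈-++⁻; ∈-map⁺; ∈-map⁻; ∈-concatMap⁺; ∈-concatMap⁻
        ; ∈-cartesianProductWith⁺; ∈-cartesianProductWith⁻; ∈-filter⁺; ∈-filter⁻ )
open import Data.List.Membership.Propositional.Properties.WithK using (unique∧set⇒bag)
open import Data.List.Membership.DecPropositional _≟_ using (_∈?_)
open import Data.List.Relation.Unary.All as All using (All; []; _∷_)
import Data.List.Relation.Unary.All.Properties as AllP
open import Data.List.Relation.Unary.All.Properties using (¬Any⇒All¬; All¬⇒¬Any; all⁺; all⁻)
open import Data.List.Relation.Unary.Any as Any using (here; there)
open import Data.List.Relation.Unary.Any.Properties using (any⁺; any⁻)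
open import Data.List.Relation.Unary.AllPairs using (AllPairs; []; _∷_)
import Data.List.Relation.Unary.AllPairs as AllPairs′
import Data.List.Relation.Unary.AllPairs.Properties as AllPairs
import Data.List.Relation.Unary.Unique.Propositional.Properties as Unique
open import Data.List.Relation.Binary.Disjoint.Propositional using (Disjoint)
open import Data.List.Relation.Binary.Subset.Propositional using (_⊆_)
open import Data.List.Relation.Binary.Subset.Propositional.Properties
  using (⊆-refl; ⊆-trans; ⊆-reflexive-↭; ⊆∷∧∉⇒⊆; ∷⁺ʳ; ∈-∷⁺ʳ; ++⁺)
open import Data.List.Relation.Binary.BagAndSetEquality using (∼bag⇒↭)
open import Data.List.Relation.Binary.Permutation.Propositional using (_↭_; ↭⇒↭ₛ; ↭-sym)
import Data.List.Relation.Binary.Permutation.Propositional.Properties as ↭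
open import Data.List.Relation.Binary.Permutation.Propositional.Properties using (↭-length; shift)
import Data.List.Relation.Binary.Permutation.Setoid.Properties as PermutationSetoid
open import Data.List.Relation.Ternary.Interleaving.Propositional
  using (Interleaving; []; consˡ; consʳ; toPermutation)
import Data.List.Relation.Ternary.Interleaving.Propositional.Properties as Interleaving
open import Data.List.Relation.Ternary.Interleaving.Properties using (interleave-length)
open import Data.Product using (_×_; _,_; ∃; proj₁; proj₂; map₁; map₂)
open import Data.Sum using (inj₁; inj₂; [_,_]′)
open import Function using (_∘_; id; Equivalence; mk⇔)
open import Relation.Nullary using (Dec; yes; no; ¬?)
open import Relation.Nullary.Decidable using (T?)
open import Relation.Binary.Definitions using (DecidableEquality)
open import Relation.Binary.PropositionalEquality
  using (_≢_; refl; sym; trans; cong; cong₂; subst; subst₂; setoid; module ≡-Reasoning)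
open import Relation.Binary.Construct.Closure.ReflexiveTransitive using (ε; _◅_; _◅◅_; gmap)

-- Binomial coefficients.  binom p q = C(p+q, p) is the number of ways to
-- choose which p of p+q labels go to the left subtree; it is defined by
-- Pascal's rule, which is exactly how the label splittings are enumerated.
binom : ℕ → ℕ → ℕ
binom zero    _       = 1
binom (suc p) zero    = 1
binom (suc p) (suc q) = binom p (suc q) + binom (suc p) q

binom-zeroʳ : ∀ p → binom p zero ≡ 1
binom-zeroʳ zero    = refl
binom-zeroʳ (suc p) = refl

binom-oneˡ : ∀ q → binom 1 q ≡ suc q
binom-oneˡ zero    = refl
binom-oneˡ (suc q) = cong suc (binom-oneˡ q)

binom-sym : ∀ p q → binom p q ≡ binom q p
binom-sym zero    q       = sym (binom-zeroʳ q)
binom-sym (suc p) zero    = refl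
binom-sym (suc p) (suc q) = begin
  binom p (suc q) + binom (suc p) q  ≡⟨ cong₂ _+_ (binom-sym p (suc q)) (binom-sym (suc p) q) ⟩
  binom (suc q) p + binom q (suc p)  ≡⟨ +-comm (binom (suc q) p) _ ⟩
  binom q (suc p) + binom (suc q) p  ∎
  where open ≡-Reasoning

binom-absorbˡ : ∀ p q → suc p * binom (suc p) q ≡ suc (p + q) * binom p q
binom-absorbˡ p       zero    = begin
  suc p * 1  ≡⟨ cong (λ n → suc n * 1) (sym (+-identityʳ p)) ⟩
  suc (p + 0) * 1  ≡⟨ cong (suc (p + 0) *_) (sym (binom-zeroʳ p)) ⟩
  suc (p + 0) * binom p zero  ∎
  where open ≡-Reasoning
binom-absorbˡ zero    (suc q) = begin
  1 * binom 1 (suc q)  ≡⟨ cong (1 *_) (binom-oneˡ (suc q)) ⟩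
  1 * suc (suc q)      ≡⟨ *-comm 1 (suc (suc q)) ⟩
  suc (suc q) * 1      ∎
  where open ≡-Reasoning
binom-absorbˡ (suc p) (suc q) = begin
  suc (suc p) * (X + Y + W)
    ≡⟨ regroup p X Y W ⟩
  suc p * (X + Y) + (X + Y) + suc (suc p) * W
    ≡⟨ cong₂ (λ u v → u + (X + Y) + v) (binom-absorbˡ p (suc q)) (binom-absorbˡ (suc p) q) ⟩
  suc (p + suc q) * X + (X + Y) + suc (suc p + q) * Y
    ≡⟨ collect p q X Y ⟩
  suc (suc p + suc q) * (X + Y)  ∎
  where
    open ≡-Reasoning
    X = binom p (suc q)
    Y = binom (suc p) q
    W = binom (suc (suc p)) q
    regroup : ∀ p X Y W → suc (suc p) * (X + Y + W) ≡ suc p * (X + Y) + (X + Y) + suc (suc p) * W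
    regroup = solve-∀
    collect : ∀ p q X Y → suc (p + suc q) * X + (X + Y) + suc (suc p + q) * Y ≡ suc (suc p + suc q) * (X + Y)
    collect = solve-∀

binom-absorbʳ : ∀ p q → suc q * binom p (suc q) ≡ suc (p + q) * binom p q
binom-absorbʳ p q = begin
  suc q * binom p (suc q)  ≡⟨ cong (suc q *_) (binom-sym p (suc q)) ⟩
  suc q * binom (suc q) p  ≡⟨ binom-absorbˡ q p ⟩
  suc (q + p) * binom q p  ≡⟨ cong₂ (λ n b → suc n * b) (+-comm q p) (binom-sym q p) ⟩
  suc (p + q) * binom p q  ∎
  where open ≡-Reasoning

binom-step : ∀ p q →
  suc p * suc q * binom (suc p) (suc q) ≡ suc (p + q) * suc (suc (p + q)) * binom p q
binom-step p q = begin
  suc p * suc q * binom (suc p) (suc q)      ≡⟨ swap (suc p) (suc q) _ ⟩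
  suc q * (suc p * binom (suc p) (suc q))    ≡⟨ cong (suc q *_) (binom-absorbˡ p (suc q)) ⟩
  suc q * (suc (p + suc q) * binom p (suc q))  ≡⟨ rotate (suc q) (suc (p + suc q)) _ ⟩
  suc (p + suc q) * (suc q * binom p (suc q))  ≡⟨ cong (suc (p + suc q) *_) (binom-absorbʳ p q) ⟩
  suc (p + suc q) * (suc (p + q) * binom p q)  ≡⟨ reorder p q (binom p q) ⟩
  suc (p + q) * suc (suc (p + q)) * binom p q  ∎
  where
    open ≡-Reasoning
    swap : ∀ a b c → a * b * c ≡ b * (a * c)
    swap = solve-∀
    rotate : ∀ a b c → a * (b * c) ≡ b * (a * c)
    rotate = solve-∀
    reorder : ∀ p q c → suc (p + suc q) * (suc (p + q) * c) ≡ suc (p + q) * suc (suc (p + q)) * c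
    reorder = solve-∀

binom-diagonal-even : ∀ p → binom (suc p) (suc p) ≡ 2 * binom (suc p) p
binom-diagonal-even p = begin
  binom p (suc p) + binom (suc p) p  ≡⟨ cong (_+ binom (suc p) p) (binom-sym p (suc p)) ⟩
  binom (suc p) p + binom (suc p) p  ≡⟨ double (binom (suc p) p) ⟩
  2 * binom (suc p) p  ∎
  where
    open ≡-Reasoning
    double : ∀ n → n + n ≡ 2 * n
    double = solve-∀

coprime-odd-2 : ∀ m → Coprime (suc (2 * m)) 2
coprime-odd-2 zero    = 1-coprimeTo 2
coprime-odd-2 (suc m) = subst (λ n → Coprime n 2) (plus-two m) (coprime-+ (coprime-odd-2 m))
  where
    plus-two : ∀ m → 2 + suc (2 * m) ≡ suc (2 * suc m)
    plus-two = solve-∀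

cancel-odd : ∀ k m {x} → 2 ^ k ∣ suc (2 * m) * x → 2 ^ k ∣ x
cancel-odd zero    m {x} _      = 1∣ x
cancel-odd (suc k) m {x} 2^k+1∣ with coprime-divisor (Coprime.sym (coprime-odd-2 m)) (m*n∣⇒m∣ 2 (2 ^ k) 2^k+1∣)
... | divides y refl =
  subst (2 ^ suc k ∣_) (*-comm 2 y) (*-monoʳ-∣ 2 (cancel-odd k m {y} (*-cancelˡ-∣ 2 2^k+1∣2[oy])))
  where
    pull-2 : ∀ m y → suc (2 * m) * (y * 2) ≡ 2 * (suc (2 * m) * y)
    pull-2 = solve-∀
    2^k+1∣2[oy] : 2 * 2 ^ k ∣ 2 * (suc (2 * m) * y)
    2^k+1∣2[oy] = subst (2 ^ suc k ∣_) (pull-2 m y) 2^k+1∣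

-- Multiplying the target by the odd number p+q+1 turns it, via binom-step,
-- into c·C(p+q+2, p+1)·((p+1)·a)·((q+1)·b), which 2·2^p·2^q divides.
twoAdic-step : ∀ {p q m} a b c → p + q ≡ 2 * m → 2 ∣ c * binom (suc p) (suc q) →
  2 ^ p ∣ suc p * a → 2 ^ q ∣ suc q * b →
  2 ^ suc (p + q) ∣ suc (suc (p + q)) * (c * (binom p q * a * b))
twoAdic-step {p} {q} {m} a b c p+q≡2m 2∣c·B 2^p∣ 2^q∣ =
  cancel-odd (suc (p + q)) m (subst₂ _∣_ powers product 2^p+q+1∣)
  where
    open ≡-Reasoning
    2^p+q+1∣ : 2 * 2 ^ p * 2 ^ q ∣ c * binom (suc p) (suc q) * (suc p * a) * (suc q * b)
    2^p+q+1∣ = *-pres-∣ (*-pres-∣ 2∣c·B 2^p∣) 2^q∣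
    powers : 2 * 2 ^ p * 2 ^ q ≡ 2 ^ suc (p + q)
    powers = trans (*-assoc 2 (2 ^ p) (2 ^ q)) (cong (2 *_) (sym (^-distribˡ-+-* 2 p q)))
    gather : ∀ c B x y a b → c * B * (x * a) * (y * b) ≡ c * (x * y * B) * a * b
    gather = solve-∀
    spread : ∀ c n k B a b → c * (n * k * B) * a * b ≡ n * (k * (c * (B * a * b)))
    spread = solve-∀
    product : c * binom (suc p) (suc q) * (suc p * a) * (suc q * b)
            ≡ suc (2 * m) * (suc (suc (p + q)) * (c * (binom p q * a * b)))
    product = begin
      c * binom (suc p) (suc q) * (suc p * a) * (suc q * b)
        ≡⟨ gather c (binom (suc p) (suc q)) (suc p) (suc q) a b ⟩
      c * (suc p * suc q * binom (suc p) (suc q)) * a * b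
        ≡⟨ cong (λ n → c * n * a * b) (binom-step p q) ⟩
      c * (suc (p + q) * suc (suc (p + q)) * binom p q) * a * b
        ≡⟨ spread c (suc (p + q)) (suc (suc (p + q))) (binom p q) a b ⟩
      suc (p + q) * (suc (suc (p + q)) * (c * (binom p q * a * b)))
        ≡⟨ cong (λ n → suc n * (suc (suc (p + q)) * (c * (binom p q * a * b)))) p+q≡2m ⟩
      suc (2 * m) * (suc (suc (p + q)) * (c * (binom p q * a * b)))  ∎

-- Two duplicate-free lists with the same elements are
-- permutations of each other, hence have the same length and the same sum
-- under any weighting; this is how the lists of Defs are compared with the
-- enumerations constructed below.
module _ {A : Set} where

  ↭-of-sameElements : ∀ {xs ys : List A} → Unique xs → Unique ys →
                      (∀ {z} → z ∈ xs ⇔ z ∈ ys) → xs ↭ ys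
  ↭-of-sameElements uxs uys same = ∼bag⇒↭ (unique∧set⇒bag uxs uys same)

  sum-sameElements : (f : A → ℕ) {xs ys : List A} → Unique xs → Unique ys →
                     (∀ {z} → z ∈ xs ⇔ z ∈ ys) → sum (map f xs) ≡ sum (map f ys)
  sum-sameElements f uxs uys same = sum-↭ (↭.map⁺ f (↭-of-sameElements uxs uys same))

  length-sameElements : {xs ys : List A} → Unique xs → Unique ys →
                        (∀ {z} → z ∈ xs ⇔ z ∈ ys) → length xs ≡ length ys
  length-sameElements uxs uys same = ↭-length (↭-of-sameElements uxs uys same)

  sum-map-++ : (f : A → ℕ) (xs ys : List A) → sum (map f (xs ++ ys)) ≡ sum (map f xs) + sum (map f ys)
  sum-map-++ f xs ys = trans (cong sum (map-++ f xs ys)) (sum-++ (map f xs) (map f ys))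

  unique-resp-↭ : ∀ {xs ys : List A} → xs ↭ ys → Unique xs → Unique ys
  unique-resp-↭ xs↭ys = PermutationSetoid.Unique-resp-↭ (setoid A) (↭⇒↭ₛ xs↭ys)

  unique-++⁻ : ∀ (xs : List A) {ys} → Unique (xs ++ ys) → Unique xs × Unique ys × Disjoint xs ys
  unique-++⁻ []       uys          = [] , uys , λ ()
  unique-++⁻ (x ∷ xs) (x∉ ∷ uxsys) with unique-++⁻ xs uxsys
  ... | uxs , uys , disjoint = AllP.++⁻ˡ xs x∉ ∷ uxs , uys , disjoint′
    where
      disjoint′ : Disjoint (x ∷ xs) _
      disjoint′ (here refl , x∈ys) = All¬⇒¬Any (AllP.++⁻ʳ xs x∉) x∈ys
      disjoint′ (there z∈xs , z∈ys) = disjoint (z∈xs , z∈ys)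

  ∈⇒↭-front : ∀ {x} {xs : List A} → x ∈ xs → ∃ λ xs′ → xs ↭ x ∷ xs′
  ∈⇒↭-front x∈xs with ∈-∃++ x∈xs
  ... | us , vs , refl = us ++ vs , shift _ us vs

  unique-⊆⇒length≤ : ∀ {xs ys : List A} → Unique xs → xs ⊆ ys → length xs ≤ length ys
  unique-⊆⇒length≤ {[]}     _            _      = z≤n
  unique-⊆⇒length≤ {x ∷ xs} (x∉xs ∷ uxs) x∷xs⊆ys with ∈⇒↭-front (x∷xs⊆ys (here refl))
  ... | ys′ , ys↭ = subst (suc (length xs) ≤_) (sym (↭-length ys↭))
    (s≤s (unique-⊆⇒length≤ uxs (⊆∷∧∉⇒⊆ xs⊆x∷ys′ (All¬⇒¬Any x∉xs))))
    where
      xs⊆x∷ys′ : xs ⊆ x ∷ ys′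
      xs⊆x∷ys′ = ⊆-trans (x∷xs⊆ys ∘ there) (⊆-reflexive-↭ ys↭)

  unique-⊈-shorter : ∀ {xs ys : List A} → Unique xs → xs ⊆ ys → length ys < length xs → ⊥
  unique-⊈-shorter uxs xs⊆ys = <⇒≱ (s≤s (unique-⊆⇒length≤ uxs xs⊆ys))

  unique-concatMap : ∀ {B : Set} (f : A → List B) {xs} → All (Unique ∘ f) xs →
                     AllPairs (λ x y → Disjoint (f x) (f y)) xs → Unique (concatMap f xs)
  unique-concatMap f uniq disjoint = Unique.concat⁺ (AllP.map⁺ uniq) (AllPairs.map⁺ disjoint)

  allPairs-refine : ∀ {P : A → Set} {R S : A → A → Set} {xs} →
                    (∀ {x y} → P y → R x y → S x y) → All P xs → AllPairs R xs → AllPairs S xs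
  allPairs-refine refine []         []         = []
  allPairs-refine refine (_ ∷ pxs)  (rx ∷ rxs) =
    All.zipWith (λ (py , r) → refine py r) (pxs , rx) ∷ allPairs-refine refine pxs rxs

module _ {A B : Set} where

  length-concatMap-const : (f : A → List B) (c : ℕ) {xs : List A} →
                           (∀ {x} → x ∈ xs → length (f x) ≡ c) → length (concatMap f xs) ≡ length xs * c
  length-concatMap-const f c {[]}     _     = refl
  length-concatMap-const f c {x ∷ xs} each = trans (length-++ (f x))
    (cong₂ _+_ (each (here refl)) (length-concatMap-const f c (each ∘ there)))

  length-cartesianProductWith : ∀ {C : Set} (f : A → B → C) xs ys →
    length (cartesianProductWith f xs ys) ≡ length xs * length ys
  length-cartesianProductWith f []       ys = refl
  length-cartesianProductWith f (x ∷ xs) ys = trans (length-++ (map (f x) ys))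
    (cong₂ _+_ (length-map (f x) ys) (length-cartesianProductWith f xs ys))

module _ {A : Set} (_≟_ : DecidableEquality A) where
  open import Data.List.Membership.DecPropositional _≟_ using () renaming (_∈?_ to _∈?ᴬ_)

  -- It shows that a
  -- labelling of N vertices by all of 1..N uses every label exactly once.
  pigeonhole : ∀ {xs ys : List A} → Unique xs → xs ⊆ ys → length ys ≤ length xs → Unique ys
  pigeonhole {xs} {[]}     _   _       _     = []
  pigeonhole {xs} {y ∷ ys} uxs xs⊆y∷ys ys≤xs with y ∈?ᴬ ys | y ∈?ᴬ xs
  ... | yes y∈ys | _       = ⊥-elim (unique-⊈-shorter uxs (⊆-trans xs⊆y∷ys (∈-∷⁺ʳ y∈ys ⊆-refl)) ys≤xs)
  ... | no y∉ys  | no y∉xs = ⊥-elim (unique-⊈-shorter uxs (⊆∷∧∉⇒⊆ xs⊆y∷ys y∉xs) ys≤xs)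
  ... | no y∉ys | yes y∈xs with ∈⇒↭-front y∈xs
  ... | xs′ , xs↭ with unique-resp-↭ xs↭ uxs
  ... | y∉xs′ ∷ uxs′ = ¬Any⇒All¬ ys y∉ys ∷ pigeonhole uxs′ xs′⊆ys ys≤xs′
    where
      xs′⊆ys : xs′ ⊆ ys
      xs′⊆ys = ⊆∷∧∉⇒⊆ (⊆-trans (⊆-reflexive-↭ (↭-sym xs↭) ∘ there) xs⊆y∷ys) (All¬⇒¬Any y∉xs′)
      ys≤xs′ : length ys ≤ length xs′
      ys≤xs′ = ≤-pred (subst (suc (length ys) ≤_) (↭-length xs↭) ys≤xs)

module _ {A : Set} {as bs cs : List A} (split : Interleaving as bs cs) where

  interleaving-⊆ : as ++ bs ⊆ cs
  interleaving-⊆ = ⊆-reflexive-↭ (↭-sym (toPermutation split))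

  interleaving-⊇ : cs ⊆ as ++ bs
  interleaving-⊇ = ⊆-reflexive-↭ (toPermutation split)

  interleaving-disjoint : Unique cs → Disjoint as bs
  interleaving-disjoint ucs = proj₂ (proj₂ (unique-++⁻ as (unique-resp-↭ (toPermutation split) ucs)))

interleaving-pairs : ∀ {A : Set} {_≺_ : A → A → Set} {as bs cs} → Interleaving as bs cs →
                     AllPairs _≺_ cs → AllPairs _≺_ as × AllPairs _≺_ bs
interleaving-pairs []             []            = [] , []
interleaving-pairs (consˡ split) (c≺ ∷ pairs) with interleaving-pairs split pairs
... | pas , pbs = AllP.anti-mono (interleaving-⊆ split ∘ ∈-++⁺ˡ) c≺ ∷ pas , pbs
interleaving-pairs (consʳ split) (c≺ ∷ pairs) with interleaving-pairs split pairs
... | pas , pbs = pas , AllP.anti-mono (interleaving-⊆ split ∘ ∈-++⁺ʳ _) c≺ ∷ pbs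

module _ {A : Set} where

  -- splits k xs enumerates the interleavings of xs whose first part has length
  -- k: these are the ways to send k of the labels xs to the left subtree.
  splits : ℕ → List A → List (List A × List A)
  splits zero    []       = ([] , []) ∷ []
  splits (suc k) []       = []
  splits zero    (x ∷ xs) = map (map₂ (x ∷_)) (splits zero xs)
  splits (suc k) (x ∷ xs) = map (map₁ (x ∷_)) (splits k xs) ++ map (map₂ (x ∷_)) (splits (suc k) xs)

  splits-sound : ∀ k xs {sp} → sp ∈ splits k xs →
                 Interleaving (proj₁ sp) (proj₂ sp) xs × length (proj₁ sp) ≡ k
  splits-sound zero    []       (here refl) = [] , refl
  splits-sound zero    (x ∷ xs) sp∈ with ∈-map⁻ (map₂ (x ∷_)) sp∈
  ... | _ , sp′∈ , refl with splits-sound zero xs sp′∈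
  ...   | split , len = consʳ split , len
  splits-sound (suc k) (x ∷ xs) sp∈ with ∈-++⁻ (map (map₁ (x ∷_)) (splits k xs)) sp∈
  ... | inj₁ sp∈ˡ with ∈-map⁻ (map₁ (x ∷_)) sp∈ˡ
  ...   | _ , sp′∈ , refl with splits-sound k xs sp′∈
  ...     | split , len = consˡ split , cong suc len
  splits-sound (suc k) (x ∷ xs) sp∈ | inj₂ sp∈ʳ with ∈-map⁻ (map₂ (x ∷_)) sp∈ʳ
  ...   | _ , sp′∈ , refl with splits-sound (suc k) xs sp′∈
  ...     | split , len = consʳ split , len

  splits-complete : ∀ {as bs xs} → Interleaving as bs xs → (as , bs) ∈ splits (length as) xs
  splits-complete []                                 = here refl
  splits-complete {xs = x ∷ _} (consˡ split)          = ∈-++⁺ˡ (∈-map⁺ (map₁ (x ∷_)) (splits-complete split))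
  splits-complete {[]} {xs = x ∷ _} (consʳ split)     = ∈-map⁺ (map₂ (x ∷_)) (splits-complete split)
  splits-complete {_ ∷ as} {xs = x ∷ xs} (consʳ split) =
    ∈-++⁺ʳ (map (map₁ (x ∷_)) (splits (length as) xs)) (∈-map⁺ (map₂ (x ∷_)) (splits-complete split))

  -- Of two entries of splits k xs (in list order), some element goes to the
  -- left in the first and to the right in the second; this is what makes the
  -- enumerated labellings pairwise distinct.
  DifferentSides : List A × List A → List A × List A → Set
  DifferentSides sp sp′ = ∃ λ z → z ∈ proj₁ sp × z ∈ proj₂ sp′

  differ-∷ˡ : ∀ x {sps} → AllPairs DifferentSides sps → AllPairs DifferentSides (map (map₁ (x ∷_)) sps)
  differ-∷ˡ x = AllPairs.map⁺ ∘ AllPairs′.map (λ (z , z∈ˡ , z∈ʳ) → z , there z∈ˡ , z∈ʳ)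

  differ-∷ʳ : ∀ x {sps} → AllPairs DifferentSides sps → AllPairs DifferentSides (map (map₂ (x ∷_)) sps)
  differ-∷ʳ x = AllPairs.map⁺ ∘ AllPairs′.map (λ (z , z∈ˡ , z∈ʳ) → z , z∈ˡ , there z∈ʳ)

  splits-differ : ∀ k xs → AllPairs DifferentSides (splits k xs)
  splits-differ zero    []       = [] ∷ []
  splits-differ (suc k) []       = []
  splits-differ zero    (x ∷ xs) = differ-∷ʳ x (splits-differ zero xs)
  splits-differ (suc k) (x ∷ xs) = AllPairs.++⁺ (differ-∷ˡ x (splits-differ k xs))
    (differ-∷ʳ x (splits-differ (suc k) xs))
    (AllP.map⁺ (All.universal (λ _ → AllP.map⁺ (All.universal (λ _ → x , here refl , here refl) _)) _))

  splits-zero-length : ∀ xs → length (splits zero xs) ≡ 1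
  splits-zero-length []       = refl
  splits-zero-length (x ∷ xs) = trans (length-map (map₂ (x ∷_)) (splits zero xs)) (splits-zero-length xs)

  splits-short : ∀ k xs → length xs < k → splits k xs ≡ []
  splits-short (suc k)       []       _           = refl
  splits-short (suc (suc k)) (x ∷ xs) (s≤s len<) rewrite
    splits-short (suc k) xs len< | splits-short (suc (suc k)) xs (m<n⇒m<1+n len<) = refl

  splits-length : ∀ k m xs → length xs ≡ k + m → length (splits k xs) ≡ binom k m
  splits-length zero    m xs       _   = splits-zero-length xs
  splits-length (suc k) m (x ∷ xs) len = begin
    length (map (map₁ (x ∷_)) (splits k xs) ++ map (map₂ (x ∷_)) (splits (suc k) xs))
      ≡⟨ length-++ (map (map₁ (x ∷_)) (splits k xs)) ⟩
    length (map (map₁ (x ∷_)) (splits k xs)) + length (map (map₂ (x ∷_)) (splits (suc k) xs))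
      ≡⟨ cong₂ _+_ (length-map (map₁ (x ∷_)) (splits k xs)) (length-map (map₂ (x ∷_)) (splits (suc k) xs)) ⟩
    length (splits k xs) + length (splits (suc k) xs)
      ≡⟨ pascal m (suc-injective len) ⟩
    binom (suc k) m  ∎
    where
      open ≡-Reasoning
      pascal : ∀ m → length xs ≡ k + m → length (splits k xs) + length (splits (suc k) xs) ≡ binom (suc k) m
      pascal zero    len′ = cong₂ _+_ (trans (splits-length k zero xs len′) (binom-zeroʳ k))
        (cong length (splits-short (suc k) xs (s≤s (≤-reflexive (trans len′ (+-identityʳ k))))))
      pascal (suc m) len′ = cong₂ _+_ (splits-length k (suc m) xs len′)
                                      (splits-length (suc k) m xs (trans len′ (+-suc k m)))

Sorted : List ℕ → Set
Sorted = AllPairs _<_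

sorted⇒unique : ∀ {xs} → Sorted xs → Unique xs
sorted⇒unique = AllPairs′.map (λ x<y x≡y → <-irrefl x≡y x<y)

sorted-head-least : ∀ {h R z} → Sorted (h ∷ R) → z ∈ h ∷ R → h ≤ z
sorted-head-least _          (here refl) = ≤-refl
sorted-head-least (h< ∷ _)   (there z∈R) = <⇒≤ (All.lookup h< z∈R)

oneTo≡applyUpTo : ∀ n → oneTo n ≡ applyUpTo suc n
oneTo≡applyUpTo zero    = refl
oneTo≡applyUpTo (suc n) = trans (cong (_∷ʳ suc n) (oneTo≡applyUpTo n)) (applyUpTo-∷ʳ suc n)

oneTo-sorted : ∀ n → Sorted (oneTo n)
oneTo-sorted n = subst Sorted (sym (oneTo≡applyUpTo n)) (AllPairs.applyUpTo⁺₁ suc n (λ i<j _ → s<s i<j))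

oneTo-length : ∀ n → length (oneTo n) ≡ n
oneTo-length n = trans (cong length (oneTo≡applyUpTo n)) (length-applyUpTo suc n)

root : LTree → ℕ
root (lleaf a)     = a
root (lnode a _ _) = a

labels-length : ∀ t → length (labels t) ≡ size (shape t)
labels-length (lleaf _)     = refl
labels-length (lnode _ l r) = cong suc (trans (length-++ (labels l)) (cong₂ _+_ (labels-length l) (labels-length r)))

lnode-injective : ∀ {a a′ l l′ r r′} → lnode a l r ≡ lnode a′ l′ r′ → l ≡ l′ × r ≡ r′
lnode-injective refl = refl , refl

data Increasing : LTree → Set where
  leaf↑ : ∀ {a} → Increasing (lleaf a)
  node↑ : ∀ {a l r} → All (a <_) (labels l ++ labels r) → Increasing l → Increasing r →
          Increasing (lnode a l r)

root-least : ∀ {t z} → Increasing t → z ∈ labels t → root t ≤ z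
root-least leaf↑          (here refl) = ≤-refl
root-least (node↑ _ _ _)  (here refl) = ≤-refl
root-least (node↑ a< _ _) (there z∈)  = <⇒≤ (All.lookup a< z∈)

record IsLabelling (s : Tree) (S : List ℕ) (t : LTree) : Set where
  field
    shape≡     : shape t ≡ s
    distinct   : Unique (labels t)
    labels⊆    : labels t ⊆ S
    labels⊇    : S ⊆ labels t
    increasing : Increasing t
open IsLabelling

memberᵇ⇒∈ : ∀ {i} xs → T (memberᵇ i xs) → i ∈ xs
memberᵇ⇒∈ {i} xs = Any.map (≡ᵇ⇒≡ i _) ∘ any⁻ (i ≡ᵇ_) xs

∈⇒memberᵇ : ∀ {i xs} → i ∈ xs → T (memberᵇ i xs)
∈⇒memberᵇ {i} = any⁺ (i ≡ᵇ_) ∘ Any.map (λ { refl → ≡⇒≡ᵇ i i refl })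

increasingᵇ⇒Increasing : ∀ t → T (increasingᵇ t) → Increasing t
increasingᵇ⇒Increasing (lleaf _)     _    = leaf↑
increasingᵇ⇒Increasing (lnode a l r) test with Equivalence.to T-∧ test
... | a<ᵇ , test′ with Equivalence.to (T-∧ {increasingᵇ l}) test′
... | testˡ , testʳ = node↑ (All.map (<ᵇ⇒< a _) (all⁺ (a <ᵇ_) _ a<ᵇ))
                            (increasingᵇ⇒Increasing l testˡ) (increasingᵇ⇒Increasing r testʳ)

Increasing⇒increasingᵇ : ∀ {t} → Increasing t → T (increasingᵇ t)
Increasing⇒increasingᵇ leaf↑                    = _
Increasing⇒increasingᵇ (node↑ {a} a< incˡ incʳ) = Equivalence.from T-∧
  (all⁻ (a <ᵇ_) (All.map <⇒<ᵇ a<) , Equivalence.from T-∧ (Increasing⇒increasingᵇ incˡ , Increasing⇒increasingᵇ incʳ))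

hookCount : Tree → ℕ
hookCount leaf       = 1
hookCount (node a b) = binom (size a) (size b) * hookCount a * hookCount b

-- The increasing labellings of a shape with the labels of a sorted list S:
-- the root takes the least label h, and for each split (A , B) of the
-- remaining labels, the subtrees take labellings with labels A and B.
labellingsOn   : Tree → List ℕ → List LTree
nodeLabellings : Tree → Tree → ℕ → List ℕ × List ℕ → List LTree

labellingsOn leaf       (x ∷ []) = lleaf x ∷ []
labellingsOn leaf       _        = []
labellingsOn (node a b) []       = []
labellingsOn (node a b) (h ∷ R)  = concatMap (nodeLabellings a b h) (splits (size a) R)

nodeLabellings a b h (A , B) = cartesianProductWith (lnode h) (labellingsOn a A) (labellingsOn b B)

data NodeView (a b : Tree) (h : ℕ) (R : List ℕ) : LTree → Set where
  via-split : ∀ {A B L Rt} → (A , B) ∈ splits (size a) R →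
              L ∈ labellingsOn a A → Rt ∈ labellingsOn b B → NodeView a b h R (lnode h L Rt)

node-view : ∀ {a b h R t} → t ∈ labellingsOn (node a b) (h ∷ R) → NodeView a b h R t
node-view {a} {b} {h} {R} t∈ with find (∈-concatMap⁻ (nodeLabellings a b h) {xs = splits (size a) R} t∈)
... | (A , B) , sp∈ , t∈′ with ∈-cartesianProductWith⁻ (lnode h) (labellingsOn a A) (labellingsOn b B) t∈′
... | L , Rt , L∈ , Rt∈ , refl = via-split sp∈ L∈ Rt∈

node-intro : ∀ {a b h R A B L Rt} → (A , B) ∈ splits (size a) R →
             L ∈ labellingsOn a A → Rt ∈ labellingsOn b B → lnode h L Rt ∈ labellingsOn (node a b) (h ∷ R)
node-intro {a} {b} {h} sp∈ L∈ Rt∈ =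
  ∈-concatMap⁺ (nodeLabellings a b h) (lose sp∈ (∈-cartesianProductWith⁺ (lnode h) L∈ Rt∈))

labellingsOn-labels : ∀ s S {t} → t ∈ labellingsOn s S → labels t ⊆ S × S ⊆ labels t
labellingsOn-labels leaf       (x ∷ [])    (here refl) = ⊆-refl , ⊆-refl
labellingsOn-labels (node a b) (h ∷ R) t∈ with node-view {a} {b} {h} {R} t∈
... | via-split {A} {B} sp∈ L∈ Rt∈ with splits-sound (size a) R sp∈
...   | split , _ with labellingsOn-labels a A L∈ | labellingsOn-labels b B Rt∈
...     | L⊆ , L⊇ | Rt⊆ , Rt⊇ =
  ∷⁺ʳ h (⊆-trans (++⁺ L⊆ Rt⊆) (interleaving-⊆ split)) ,
  ∷⁺ʳ h (⊆-trans (interleaving-⊇ split) (++⁺ L⊇ Rt⊇))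

labellingsOn-sound : ∀ s S {t} → Sorted S → t ∈ labellingsOn s S → IsLabelling s S t
labellingsOn-sound leaf       (x ∷ []) _ (here refl) = record
  { shape≡ = refl ; distinct = [] ∷ [] ; labels⊆ = ⊆-refl ; labels⊇ = ⊆-refl ; increasing = leaf↑ }
labellingsOn-sound (node a b) (h ∷ R) (h< ∷ sorted) t∈ with node-view {a} {b} {h} {R} t∈
... | via-split {A} {B} {L} {Rt} sp∈ L∈ Rt∈ = record
  { shape≡     = cong₂ node (shape≡ isL) (shape≡ isRt)
  ; distinct   = All.map (λ h<z h≡z → <-irrefl h≡z h<z) h<children
                 ∷ Unique.++⁺ (distinct isL) (distinct isRt) childrenDisjoint
  ; labels⊆    = proj₁ (labellingsOn-labels (node a b) (h ∷ R) t∈)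
  ; labels⊇    = proj₂ (labellingsOn-labels (node a b) (h ∷ R) t∈)
  ; increasing = node↑ h<children (increasing isL) (increasing isRt)
  }
  where
    split = proj₁ (splits-sound (size a) R sp∈)
    isL  = labellingsOn-sound a A (proj₁ (interleaving-pairs split sorted)) L∈
    isRt = labellingsOn-sound b B (proj₂ (interleaving-pairs split sorted)) Rt∈
    h<children : All (h <_) (labels L ++ labels Rt)
    h<children = AllP.anti-mono (⊆-trans (++⁺ (labels⊆ isL) (labels⊆ isRt)) (interleaving-⊆ split)) h<
    childrenDisjoint : Disjoint (labels L) (labels Rt)
    childrenDisjoint (z∈L , z∈Rt) =
      interleaving-disjoint split (sorted⇒unique sorted) (labels⊆ isL z∈L , labels⊆ isRt z∈Rt)

node-labelling-children : ∀ {s h R m L Rt} → Sorted (h ∷ R) → IsLabelling s (h ∷ R) (lnode m L Rt) →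
  m ≡ h × labels L ++ labels Rt ⊆ R × R ⊆ labels L ++ labels Rt
node-labelling-children {h = h} {m = m} sorted@(h< ∷ _) isT with distinct isT
... | m∉children ∷ _ = m≡h , children⊆R , R⊆children
  where
    m≡h : m ≡ h
    m≡h = ≤-antisym (root-least (increasing isT) (labels⊇ isT (here refl)))
                    (sorted-head-least sorted (labels⊆ isT (here refl)))
    children⊆R = ⊆∷∧∉⇒⊆ (labels⊆ isT ∘ there)
                        (λ h∈children → All.lookup m∉children h∈children m≡h)
    R⊆children = ⊆∷∧∉⇒⊆ (labels⊇ isT ∘ there)
                        (λ m∈R → <-irrefl (sym m≡h) (All.lookup h< m∈R))

children-labellings : ∀ {h R m L Rt} → Sorted (h ∷ R) →
  IsLabelling (node (shape L) (shape Rt)) (h ∷ R) (lnode m L Rt) →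
  IsLabelling (shape L) (filter (_∈? labels L) R) L ×
  IsLabelling (shape Rt) (filter (¬? ∘ (_∈? labels L)) R) Rt
children-labellings {R = R} {L = L} {Rt} sorted isT
  with node-labelling-children sorted isT | distinct isT | increasing isT
... | _ , children⊆R , R⊆children | _ ∷ uchildren | node↑ _ incL incRt
  with unique-++⁻ (labels L) uchildren
... | uL , uRt , disjoint = isL , isRt
  where
    inL? = λ z → z ∈? labels L
    isL : IsLabelling (shape L) (filter inL? R) L
    isL = record
      { shape≡ = refl ; distinct = uL ; increasing = incL
      ; labels⊆ = λ z∈L → ∈-filter⁺ inL? (children⊆R (∈-++⁺ˡ z∈L)) z∈L
      ; labels⊇ = proj₂ ∘ ∈-filter⁻ inL? {xs = R} }
    isRt : IsLabelling (shape Rt) (filter (¬? ∘ inL?) R) Rt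
    isRt = record
      { shape≡ = refl ; distinct = uRt ; increasing = incRt
      ; labels⊆ = λ z∈Rt → ∈-filter⁺ (¬? ∘ inL?) (children⊆R (∈-++⁺ʳ (labels L) z∈Rt))
                                      (λ z∈L → disjoint (z∈L , z∈Rt))
      ; labels⊇ = λ z∈B → let z∈R , z∉L = ∈-filter⁻ (¬? ∘ inL?) {xs = R} z∈B in
                  [ (λ z∈L → ⊥-elim (z∉L z∈L)) , id ]′ (∈-++⁻ (labels L) (R⊆children z∈R)) }

-- Every increasing labelling with labels S is enumerated: the split of the
-- labels is recovered by filtering S by membership in the left subtree.
labellingsOn-complete : ∀ S t → Sorted S → IsLabelling (shape t) S t → t ∈ labellingsOn (shape t) S
labellingsOn-complete []           (lleaf z) _                 isT with labels⊆ isT (here refl)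
... | ()
labellingsOn-complete (x ∷ [])     (lleaf z) _                 isT with labels⊆ isT (here refl)
... | here refl = here refl
labellingsOn-complete (x ∷ y ∷ ys) (lleaf z) ((x<y ∷ _) ∷ _)  isT
  with labels⊇ isT (here refl) | labels⊇ isT (there (here refl))
... | here refl | here refl = ⊥-elim (<-irrefl refl x<y)
labellingsOn-complete []           (lnode m L Rt) _ isT with labels⊆ isT (here refl)
... | ()
labellingsOn-complete (h ∷ R) (lnode m L Rt) sorted@(_ ∷ sortedR) isT
  with node-labelling-children sorted isT | children-labellings sorted isT
... | refl , _ | isL , isRt = node-intro {shape L} {shape Rt} sp∈
      (labellingsOn-complete _ L (proj₁ (interleaving-pairs split sortedR)) isL)
      (labellingsOn-complete _ Rt (proj₂ (interleaving-pairs split sortedR)) isRt)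
  where
    inL? = λ z → z ∈? labels L
    split = Interleaving.filter⁺ inL? R
    A-length : length (filter inL? R) ≡ size (shape L)
    A-length = trans (length-sameElements (Unique.filter⁺ inL? (sorted⇒unique sortedR)) (distinct isL)
                                          (mk⇔ (labels⊇ isL) (labels⊆ isL)))
                     (labels-length L)
    sp∈ = subst (λ k → (filter inL? R , filter (¬? ∘ inL?) R) ∈ splits k R) A-length (splits-complete split)

labellingsOn-unique : ∀ s S → Sorted S → Unique (labellingsOn s S)
labellingsOn-unique leaf       []           _ = []
labellingsOn-unique leaf       (x ∷ [])     _ = [] ∷ []
labellingsOn-unique leaf       (x ∷ y ∷ ys) _ = []
labellingsOn-unique (node a b) []           _ = []
labellingsOn-unique (node a b) (h ∷ R) (_ ∷ sorted) =
  unique-concatMap (nodeLabellings a b h) (All.tabulate eachUnique)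
    (allPairs-refine separated (All.tabulate partsDisjoint) (splits-differ (size a) R))
  where
    eachUnique : ∀ {sp} → sp ∈ splits (size a) R → Unique (nodeLabellings a b h sp)
    eachUnique sp∈ with interleaving-pairs (proj₁ (splits-sound (size a) R sp∈)) sorted
    ... | sortedA , sortedB = Unique.cartesianProductWith⁺ (lnode h) lnode-injective
                                (labellingsOn-unique a _ sortedA) (labellingsOn-unique b _ sortedB)
    partsDisjoint : ∀ {sp} → sp ∈ splits (size a) R → Disjoint (proj₁ sp) (proj₂ sp)
    partsDisjoint sp∈ = interleaving-disjoint (proj₁ (splits-sound (size a) R sp∈)) (sorted⇒unique sorted)
    separated : ∀ {sp sp′} → Disjoint (proj₁ sp′) (proj₂ sp′) → DifferentSides sp sp′ →
                Disjoint (nodeLabellings a b h sp) (nodeLabellings a b h sp′)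
    separated {A , B} {A′ , B′} disjoint′ (z , z∈A , z∈B′) (t∈ , t∈′)
      with ∈-cartesianProductWith⁻ (lnode h) (labellingsOn a A) (labellingsOn b B) t∈
         | ∈-cartesianProductWith⁻ (lnode h) (labellingsOn a A′) (labellingsOn b B′) t∈′
    ... | L , _ , L∈ , _ , refl | _ , _ , L∈′ , _ , t≡ with lnode-injective t≡
    ...   | refl , refl = disjoint′ (proj₁ (labellingsOn-labels a A′ L∈′) (proj₂ (labellingsOn-labels a A L∈) z∈A) , z∈B′)

labellingsOn-count : ∀ s S → length S ≡ size s → length (labellingsOn s S) ≡ hookCount s
labellingsOn-count leaf       (x ∷ []) _   = refl
labellingsOn-count (node a b) (h ∷ R)  len = begin
  length (concatMap (nodeLabellings a b h) (splits (size a) R))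
    ≡⟨ length-concatMap-const (nodeLabellings a b h) (hookCount a * hookCount b) each ⟩
  length (splits (size a) R) * (hookCount a * hookCount b)
    ≡⟨ cong (_* (hookCount a * hookCount b)) (splits-length (size a) (size b) R (suc-injective len)) ⟩
  binom (size a) (size b) * (hookCount a * hookCount b)
    ≡⟨ sym (*-assoc (binom (size a) (size b)) (hookCount a) (hookCount b)) ⟩
  hookCount (node a b)  ∎
  where
    open ≡-Reasoning
    each : ∀ {sp} → sp ∈ splits (size a) R → length (nodeLabellings a b h sp) ≡ hookCount a * hookCount b
    each {A , B} sp∈ with splits-sound (size a) R sp∈
    ... | split , A-length = trans (length-cartesianProductWith (lnode h) (labellingsOn a A) (labellingsOn b B))
      (cong₂ _*_ (labellingsOn-count a A A-length) (labellingsOn-count b B B-length))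
      where
        B-length : length B ≡ size b
        B-length = +-cancelˡ-≡ (size a) (length B) (size b)
          (trans (cong (_+ length B) (sym A-length)) (trans (sym (interleave-length split)) (suc-injective len)))

labellingsFrom-sound : ∀ pool s {t} → t ∈ labellingsFrom pool s → shape t ≡ s × labels t ⊆ pool
labellingsFrom-sound pool leaf t∈ with ∈-map⁻ lleaf t∈
... | _ , a∈ , refl = refl , λ { (here refl) → a∈ }
labellingsFrom-sound pool (node l r) t∈ with find (∈-concatMap⁻ _ {xs = pool} t∈)
... | a , a∈ , t∈₁ with find (∈-concatMap⁻ _ {xs = labellingsFrom pool l} t∈₁)
...   | L , L∈ , t∈₂ with ∈-map⁻ (lnode a L) t∈₂
...     | Rt , Rt∈ , refl with labellingsFrom-sound pool l L∈ | labellingsFrom-sound pool r Rt∈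
...       | refl , L⊆ | refl , Rt⊆ = refl , ∈-∷⁺ʳ a∈ ([ L⊆ , Rt⊆ ]′ ∘ ∈-++⁻ (labels L))

labellingsFrom-complete : ∀ pool t → labels t ⊆ pool → t ∈ labellingsFrom pool (shape t)
labellingsFrom-complete pool (lleaf a)      t⊆ = ∈-map⁺ lleaf (t⊆ (here refl))
labellingsFrom-complete pool (lnode a L Rt) t⊆ =
  ∈-concatMap⁺ _ (lose (t⊆ (here refl)) (∈-concatMap⁺ _ (lose
    (labellingsFrom-complete pool L (t⊆ ∘ there ∘ ∈-++⁺ˡ))
    (∈-map⁺ (lnode a L) (labellingsFrom-complete pool Rt (t⊆ ∘ there ∘ ∈-++⁺ʳ (labels L)))))))

labellingsFrom-unique : ∀ pool s → Unique pool → Unique (labellingsFrom pool s)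
labellingsFrom-unique pool leaf       upool = Unique.map⁺ (λ { refl → refl }) upool
labellingsFrom-unique pool (node l r) upool =
  unique-concatMap withRoot (All.universal withRoot-unique pool) (AllPairs′.map differentRoots upool)
  where
    withRoot : ℕ → List LTree
    withRoot a = concatMap (λ L → map (lnode a L) (labellingsFrom pool r)) (labellingsFrom pool l)
    withRoot-unique : ∀ a → Unique (withRoot a)
    withRoot-unique a = unique-concatMap _
      (All.universal (λ L → Unique.map⁺ (proj₂ ∘ lnode-injective) (labellingsFrom-unique pool r upool)) _)
      (AllPairs′.map differentLeft (labellingsFrom-unique pool l upool))
      where
        differentLeft : ∀ {L L′} → L ≢ L′ →
          Disjoint (map (lnode a L) (labellingsFrom pool r)) (map (lnode a L′) (labellingsFrom pool r))
        differentLeft L≢L′ (t∈ , t∈′) with ∈-map⁻ _ t∈ | ∈-map⁻ _ t∈′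
        ... | _ , _ , refl | _ , _ , t≡ = L≢L′ (proj₁ (lnode-injective t≡))
    root-withRoot : ∀ {a t} → t ∈ withRoot a → root t ≡ a
    root-withRoot {a} t∈ with find (∈-concatMap⁻ _ {xs = labellingsFrom pool l} t∈)
    ... | L , _ , t∈′ with ∈-map⁻ (lnode a L) t∈′
    ...   | _ , _ , refl = refl
    differentRoots : ∀ {a a′} → a ≢ a′ → Disjoint (withRoot a) (withRoot a′)
    differentRoots a≢a′ (t∈ , t∈′) = a≢a′ (trans (sym (root-withRoot t∈)) (root-withRoot t∈′))

-- Distinctness of the labels comes from the pigeonhole
-- principle: t has N labels and they cover all of 1..N.
test⇒IsLabelling : ∀ s t → shape t ≡ s → labels t ⊆ oneTo (size s) →
                   T (isIncreasingLabellingᵇ s t) → IsLabelling s (oneTo (size s)) t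
test⇒IsLabelling s t refl t⊆pool passes
  with Equivalence.to (T-∧ {all (λ i → memberᵇ i (labels t)) (oneTo (size s))}) passes
... | covered , increasingᵇ = record
  { shape≡ = refl
  ; distinct = pigeonhole _≟_ (sorted⇒unique (oneTo-sorted (size s))) pool⊆t
                 (≤-reflexive (trans (labels-length t) (sym (oneTo-length (size s)))))
  ; labels⊆ = t⊆pool
  ; labels⊇ = pool⊆t
  ; increasing = increasingᵇ⇒Increasing t increasingᵇ }
  where
    pool⊆t : oneTo (size s) ⊆ labels t
    pool⊆t = memberᵇ⇒∈ (labels t) ∘ All.lookup (all⁺ _ (oneTo (size s)) covered)

IsLabelling⇒test : ∀ {s t} → IsLabelling s (oneTo (size s)) t → T (isIncreasingLabellingᵇ s t)
IsLabelling⇒test isT = Equivalence.from T-∧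
  (all⁻ _ (All.tabulate (∈⇒memberᵇ ∘ labels⊇ isT)) , Increasing⇒increasingᵇ (increasing isT))

incLabellings-elements : ∀ s {t} → t ∈ incLabellings s ⇔ t ∈ labellingsOn s (oneTo (size s))
incLabellings-elements s {t} = mk⇔ to from
  where
    pool = oneTo (size s)
    test = isIncreasingLabellingᵇ s
    to : t ∈ incLabellings s → t ∈ labellingsOn s pool
    to t∈ with ∈-filter⁻ (T? ∘ test) {xs = labellingsFrom pool s} t∈
    ... | t∈all , passes with labellingsFrom-sound pool s t∈all
    ...   | refl , t⊆pool =
      labellingsOn-complete pool t (oneTo-sorted (size s)) (test⇒IsLabelling s t refl t⊆pool passes)
    from : t ∈ labellingsOn s pool → t ∈ incLabellings s
    from t∈ with labellingsOn-sound s pool (oneTo-sorted (size s)) t∈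
    ... | isT = ∈-filter⁺ (T? ∘ test)
      (subst (λ s → t ∈ labellingsFrom pool s) (shape≡ isT) (labellingsFrom-complete pool t (labels⊆ isT)))
      (IsLabelling⇒test isT)

#L≡hookCount : ∀ s → #L s ≡ hookCount s
#L≡hookCount s = begin
  length (incLabellings s)           ≡⟨ length-sameElements uniqueFiltered (labellingsOn-unique s pool sorted)
                                                            (incLabellings-elements s) ⟩
  length (labellingsOn s pool)       ≡⟨ labellingsOn-count s pool (oneTo-length (size s)) ⟩
  hookCount s                        ∎
  where
    open ≡-Reasoning
    pool = oneTo (size s)
    sorted = oneTo-sorted (size s)
    uniqueFiltered : Unique (incLabellings s)
    uniqueFiltered = Unique.filter⁺ (T? ∘ isIncreasingLabellingᵇ s) (labellingsFrom-unique pool s (sorted⇒unique sorted))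

-- It coincides with the
-- closure _~_ of basic pivotings, but is decidable and easy to recurse on.
infix 4 _≅_
data _≅_ : Tree → Tree → Set where
  leaf≅    : leaf ≅ leaf
  straight : ∀ {l r a b} → l ≅ a → r ≅ b → node l r ≅ node a b
  crossed  : ∀ {l r a b} → l ≅ b → r ≅ a → node l r ≅ node a b

≅-refl : ∀ {t} → t ≅ t
≅-refl {leaf}     = leaf≅
≅-refl {node l r} = straight ≅-refl ≅-refl

≅-sym : ∀ {s t} → s ≅ t → t ≅ s
≅-sym leaf≅          = leaf≅
≅-sym (straight p q) = straight (≅-sym p) (≅-sym q)
≅-sym (crossed p q)  = crossed (≅-sym q) (≅-sym p)

≅-trans : ∀ {s t u} → s ≅ t → t ≅ u → s ≅ u
≅-trans leaf≅          leaf≅          = leaf≅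
≅-trans (straight p q) (straight p′ q′) = straight (≅-trans p p′) (≅-trans q q′)
≅-trans (straight p q) (crossed p′ q′)  = crossed (≅-trans p p′) (≅-trans q q′)
≅-trans (crossed p q)  (straight p′ q′) = crossed (≅-trans p q′) (≅-trans q p′)
≅-trans (crossed p q)  (crossed p′ q′)  = straight (≅-trans p q′) (≅-trans q p′)

_≅?_ : ∀ s t → Dec (s ≅ t)
leaf     ≅? leaf     = yes leaf≅
leaf     ≅? node _ _ = no λ ()
node _ _ ≅? leaf     = no λ ()
node l r ≅? node a b with l ≅? a | r ≅? b | l ≅? b | r ≅? a
... | yes p | yes q | _     | _     = yes (straight p q)
... | _     | _     | yes p | yes q = yes (crossed p q)
... | no ¬p | _     | no ¬p′ | _     = no λ { (straight p _) → ¬p p ; (crossed p′ _) → ¬p′ p′ }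
... | no ¬p | _     | _     | no ¬q′ = no λ { (straight p _) → ¬p p ; (crossed _ q′) → ¬q′ q′ }
... | _     | no ¬q | no ¬p′ | _     = no λ { (straight _ q) → ¬q q ; (crossed p′ _) → ¬p′ p′ }
... | _     | no ¬q | _     | no ¬q′ = no λ { (straight _ q) → ¬q q ; (crossed _ q′) → ¬q′ q′ }

≅-size : ∀ {s t} → s ≅ t → size s ≡ size t
≅-size leaf≅          = refl
≅-size (straight p q) = cong₂ (λ m n → suc (m + n)) (≅-size p) (≅-size q)
≅-size (crossed {a = a} {b = b} p q) =
  trans (cong₂ (λ m n → suc (m + n)) (≅-size p) (≅-size q)) (cong suc (+-comm (size b) (size a)))

pivot⇒≅ : ∀ {s t} → Pivot s t → s ≅ t
pivot⇒≅ here      = crossed ≅-refl ≅-refl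
pivot⇒≅ (left p)  = straight (pivot⇒≅ p) ≅-refl
pivot⇒≅ (right p) = straight ≅-refl (pivot⇒≅ p)

~⇒≅ : ∀ {s t} → s ~ t → s ≅ t
~⇒≅ ε        = ≅-refl
~⇒≅ (p ◅ ps) = ≅-trans (pivot⇒≅ p) (~⇒≅ ps)

node-cong~ : ∀ {l r a b} → l ~ a → r ~ b → node l r ~ node a b
node-cong~ {r = r} {a = a} l~a r~b = gmap (λ x → node x r) left l~a ◅◅ gmap (node a) right r~b

≅⇒~ : ∀ {s t} → s ≅ t → s ~ t
≅⇒~ leaf≅          = ε
≅⇒~ (straight p q) = node-cong~ (≅⇒~ p) (≅⇒~ q)
≅⇒~ (crossed p q)  = node-cong~ (≅⇒~ p) (≅⇒~ q) ◅◅ (here ◅ ε)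

pairs : List Tree → List Tree → List Tree
pairs = cartesianProductWith node

node-injective : ∀ {l l′ r r′} → node l r ≡ node l′ r′ → l ≡ l′ × r ≡ r′
node-injective refl = refl , refl

classList : Tree → List Tree
classList leaf       = leaf ∷ []
classList (node l r) with l ≅? r
... | yes _ = pairs (classList l) (classList r)
... | no _  = pairs (classList l) (classList r) ++ pairs (classList r) (classList l)

classList-sound : ∀ t {s} → s ∈ classList t → t ≅ s
classList-sound leaf (here refl) = leaf≅
classList-sound (node l r) s∈ with l ≅? r
... | yes _ with ∈-cartesianProductWith⁻ node (classList l) (classList r) s∈
...   | a , b , a∈ , b∈ , refl = straight (classList-sound l a∈) (classList-sound r b∈)
classList-sound (node l r) s∈ | no _ with ∈-++⁻ (pairs (classList l) (classList r)) s∈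
...   | inj₁ s∈₁ with ∈-cartesianProductWith⁻ node (classList l) (classList r) s∈₁
...     | a , b , a∈ , b∈ , refl = straight (classList-sound l a∈) (classList-sound r b∈)
classList-sound (node l r) s∈ | no _ | inj₂ s∈₂ with ∈-cartesianProductWith⁻ node (classList r) (classList l) s∈₂
...     | a , b , a∈ , b∈ , refl = crossed (classList-sound l b∈) (classList-sound r a∈)

classList-complete : ∀ t {s} → t ≅ s → s ∈ classList t
classList-complete leaf leaf≅ = here refl
classList-complete (node l r) t≅s with l ≅? r
classList-complete (node l r) (straight l≅a r≅b) | yes _ =
  ∈-cartesianProductWith⁺ node (classList-complete l l≅a) (classList-complete r r≅b)
classList-complete (node l r) (crossed l≅b r≅a)  | yes l≅r =
  ∈-cartesianProductWith⁺ node (classList-complete l (≅-trans l≅r r≅a)) (classList-complete r (≅-trans (≅-sym l≅r) l≅b))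
classList-complete (node l r) (straight l≅a r≅b) | no _ =
  ∈-++⁺ˡ (∈-cartesianProductWith⁺ node (classList-complete l l≅a) (classList-complete r r≅b))
classList-complete (node l r) (crossed l≅b r≅a)  | no _ =
  ∈-++⁺ʳ (pairs (classList l) (classList r)) (∈-cartesianProductWith⁺ node (classList-complete r r≅a) (classList-complete l l≅b))

classList-unique : ∀ t → Unique (classList t)
classList-unique leaf       = [] ∷ []
classList-unique (node l r) with l ≅? r
... | yes _   = Unique.cartesianProductWith⁺ node node-injective (classList-unique l) (classList-unique r)
... | no l≇r  = Unique.++⁺ (Unique.cartesianProductWith⁺ node node-injective (classList-unique l) (classList-unique r))
                           (Unique.cartesianProductWith⁺ node node-injective (classList-unique r) (classList-unique l))
                           straight≠crossed
  where
    straight≠crossed : Disjoint (pairs (classList l) (classList r)) (pairs (classList r) (classList l))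
    straight≠crossed (s∈ , s∈′)
      with ∈-cartesianProductWith⁻ node (classList l) (classList r) s∈
         | ∈-cartesianProductWith⁻ node (classList r) (classList l) s∈′
    ... | a , _ , a∈ , _ , refl | a′ , _ , a′∈ , _ , s≡ with node-injective s≡
    ...   | refl , refl = l≇r (≅-trans (classList-sound l a∈) (≅-sym (classList-sound r a′∈)))

-- The class total T, by the recursion that sums over classes obey: the classes
-- of the two subtrees combine in c orders, c = 1 if l ~ r and c = 2 otherwise.
multiplicity : ∀ {l r} → Dec (l ≅ r) → ℕ
multiplicity (yes _) = 1
multiplicity (no _)  = 2

classTotal : Tree → ℕ
classTotal leaf       = 1
classTotal (node l r) = multiplicity (l ≅? r) * (binom (size l) (size r) * classTotal l * classTotal r)

classList-sizes : ∀ t → All (λ s → size s ≡ size t) (classList t)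
classList-sizes t = All.tabulate (sym ∘ ≅-size ∘ classList-sound t)

sum-row : ∀ {p q} x ys → size x ≡ p → All (λ y → size y ≡ q) ys →
  sum (map hookCount (map (node x) ys)) ≡ binom p q * hookCount x * sum (map hookCount ys)
sum-row {p} {q} x [] _ _ = sym (*-zeroʳ (binom p q * hookCount x))
sum-row x (y ∷ ys) refl (refl ∷ ys-size) =
  trans (cong (hookCount (node x y) +_) (sum-row x ys refl ys-size))
        (sym (*-distribˡ-+ (binom (size x) (size y) * hookCount x) (hookCount y) _))

sum-pairs : ∀ {p q} xs ys → All (λ x → size x ≡ p) xs → All (λ y → size y ≡ q) ys →
  sum (map hookCount (pairs xs ys)) ≡ binom p q * sum (map hookCount xs) * sum (map hookCount ys)
sum-pairs {p} {q} []       ys _                 _       = sym (cong (_* sum (map hookCount ys)) (*-zeroʳ (binom p q)))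
sum-pairs {p} {q} (x ∷ xs) ys (x-size ∷ xs-size) ys-size = begin
  sum (map hookCount (map (node x) ys ++ pairs xs ys))
    ≡⟨ sum-map-++ hookCount (map (node x) ys) (pairs xs ys) ⟩
  sum (map hookCount (map (node x) ys)) + sum (map hookCount (pairs xs ys))
    ≡⟨ cong₂ _+_ (sum-row x ys x-size ys-size) (sum-pairs xs ys xs-size ys-size) ⟩
  binom p q * hookCount x * Σys + binom p q * Σxs * Σys
    ≡⟨ factor (binom p q) (hookCount x) Σxs Σys ⟩
  binom p q * (hookCount x + Σxs) * Σys  ∎
  where
    open ≡-Reasoning
    Σxs = sum (map hookCount xs)
    Σys = sum (map hookCount ys)
    factor : ∀ c x s t → c * x * t + c * s * t ≡ c * (x + s) * t
    factor = solve-∀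

sum-classList : ∀ t → sum (map hookCount (classList t)) ≡ classTotal t
sum-classList leaf       = refl
sum-classList (node l r) with l ≅? r
... | yes _ = begin
  sum (map hookCount (pairs (classList l) (classList r)))
    ≡⟨ sum-pairs (classList l) (classList r) (classList-sizes l) (classList-sizes r) ⟩
  binom (size l) (size r) * Σl * Σr
    ≡⟨ cong₂ (λ x y → binom (size l) (size r) * x * y) (sum-classList l) (sum-classList r) ⟩
  binom (size l) (size r) * classTotal l * classTotal r
    ≡⟨ sym (*-identityˡ _) ⟩
  1 * (binom (size l) (size r) * classTotal l * classTotal r)  ∎
  where
    open ≡-Reasoning
    Σl = sum (map hookCount (classList l))
    Σr = sum (map hookCount (classList r))
... | no _ = begin
  sum (map hookCount (pairs (classList l) (classList r) ++ pairs (classList r) (classList l)))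
    ≡⟨ sum-map-++ hookCount (pairs (classList l) (classList r)) (pairs (classList r) (classList l)) ⟩
  sum (map hookCount (pairs (classList l) (classList r))) + sum (map hookCount (pairs (classList r) (classList l)))
    ≡⟨ cong₂ _+_ (sum-pairs (classList l) (classList r) (classList-sizes l) (classList-sizes r))
                 (sum-pairs (classList r) (classList l) (classList-sizes r) (classList-sizes l)) ⟩
  binom (size l) (size r) * Σl * Σr + binom (size r) (size l) * Σr * Σl
    ≡⟨ cong (λ c → binom (size l) (size r) * Σl * Σr + c * Σr * Σl) (binom-sym (size r) (size l)) ⟩
  binom (size l) (size r) * Σl * Σr + binom (size l) (size r) * Σr * Σl
    ≡⟨ both-orders (binom (size l) (size r)) Σl Σr ⟩
  2 * (binom (size l) (size r) * Σl * Σr)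
    ≡⟨ cong₂ (λ x y → 2 * (binom (size l) (size r) * x * y)) (sum-classList l) (sum-classList r) ⟩
  2 * (binom (size l) (size r) * classTotal l * classTotal r)  ∎
  where
    open ≡-Reasoning
    Σl = sum (map hookCount (classList l))
    Σr = sum (map hookCount (classList r))
    both-orders : ∀ c x y → c * x * y + c * y * x ≡ 2 * (c * x * y)
    both-orders = solve-∀

classSum : ∀ t cls → Unique cls → (∀ s → (s ∈ cls) ⇔ (t ~ s)) → sum (map #L cls) ≡ classTotal t
classSum t cls ucls cls⇔class = begin
  sum (map #L cls)                    ≡⟨ sum-sameElements #L ucls (classList-unique t) same ⟩
  sum (map #L (classList t))          ≡⟨ cong sum (map-cong #L≡hookCount (classList t)) ⟩
  sum (map hookCount (classList t))   ≡⟨ sum-classList t ⟩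
  classTotal t                        ∎
  where
    open ≡-Reasoning
    same : ∀ {s} → s ∈ cls ⇔ s ∈ classList t
    same {s} = mk⇔ (classList-complete t ∘ ~⇒≅ ∘ Equivalence.to (cls⇔class s))
                   (Equivalence.from (cls⇔class s) ∘ ≅⇒~ ∘ classList-sound t)

size-odd : ∀ t → ∃ λ m → size t ≡ suc (2 * m)
size-odd leaf       = 0 , refl
size-odd (node l r) with size-odd l | size-odd r
... | m₁ , size-l | m₂ , size-r = suc (m₁ + m₂) , cong suc (trans (cong₂ _+_ size-l size-r) (add-odd m₁ m₂))
  where
    add-odd : ∀ m₁ m₂ → suc (2 * m₁) + suc (2 * m₂) ≡ 2 * suc (m₁ + m₂)
    add-odd = solve-∀

-- c·C(|l|+|r|+2, |l|+1) is always even: either c = 2, or l ~ r and the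
-- binomial coefficient is a central one.
multiplicity-even : ∀ {l r} (l≅?r : Dec (l ≅ r)) → 2 ∣ multiplicity l≅?r * binom (suc (size l)) (suc (size r))
multiplicity-even {l} (yes l≅r) = subst (λ q → 2 ∣ 1 * binom (suc (size l)) (suc q)) (≅-size l≅r)
  (∣n⇒∣m*n 1 (divides (binom (suc (size l)) (size l))
    (trans (binom-diagonal-even (size l)) (*-comm 2 (binom (suc (size l)) (size l))))))
multiplicity-even {l} {r} (no _) = m∣m*n (binom (suc (size l)) (suc (size r)))

classTotal-2adic : ∀ t → 2 ^ size t ∣ suc (size t) * classTotal t
classTotal-2adic leaf       = divides 1 refl
classTotal-2adic (node l r) with size-odd (node l r)
... | m , size-t =
  twoAdic-step {size l} {size r} {m} (classTotal l) (classTotal r) (multiplicity (l ≅? r))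
    (suc-injective size-t) (multiplicity-even (l ≅? r)) (classTotal-2adic l) (classTotal-2adic r)

-- The theorem: with |t| = 2n+1, the invariant is 2·2^(2n) | 2·(n+1)·T(t).
proposition2p1 : (n : ℕ) (t : Tree) → size t ≡ 2 * n + 1 →
    (cls : List Tree) → Unique cls → (∀ s → (s ∈ cls) ⇔ (t ~ s)) →
    (2 ^ (2 * n)) ∣ ((n + 1) * sum (map #L cls))
proposition2p1 n t size-t cls ucls cls⇔class =
  *-cancelˡ-∣ 2 (subst₂ _∣_ power factor (classTotal-2adic t))
  where
    power : 2 ^ size t ≡ 2 * 2 ^ (2 * n)
    power = cong (2 ^_) (trans size-t (+-comm (2 * n) 1))
    rearrange : ∀ n T → suc (2 * n + 1) * T ≡ 2 * ((n + 1) * T)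
    rearrange = solve-∀
    factor : suc (size t) * classTotal t ≡ 2 * ((n + 1) * sum (map #L cls))
    factor = begin
      suc (size t) * classTotal t                 ≡⟨ cong₂ (λ k T → suc k * T) size-t (sym (classSum t cls ucls cls⇔class)) ⟩
      suc (2 * n + 1) * sum (map #L cls)          ≡⟨ rearrange n _ ⟩
      2 * ((n + 1) * sum (map #L cls))            ∎
      where open ≡-Reasoning
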